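{- Let $(\Sigma,<)$ be a finite totally ordered alphabet and let $m,\ell_1,\ldots,\ell_h\in\Sigma^+$ be such that (1) $m$ is an inverse Lyndon word; (2) $\ell_1,\ldots,\ell_h$ are anti-Lyndon words with $\ell_i$ a prefix of $\ell_{i-1}$ for $1<i\le h$; (3) $m=\ell_1\cdots\ell_h$. Then $\mathrm{CFL}_{in}(m)=\mathcal{NB}(m)$.
   Context: Lexicographic order $\prec$ on $\Sigma^*$: $x\prec y$ if $x$ is a proper prefix of $y$, or $x=ras$, $y=rbt$ with $a,b\in\Sigma$, $a<b$. An inverse Lyndon word is a $u\in\Sigma^+$ with $s\prec u$ for each nonempty proper suffix $s$ of $u$. Inverse order $<_{in}$: $b<_{in}a\iff a<b$; $\prec_{in}$ the induced lexicographic order. An anti-Lyndon word is a nonempty primitive word strictly smaller for $\prec_{in}$ than all its other conjugates. $\mathrm{CFL}_{in}(w)$ is the unique sequence $(\lambda_1,\ldots,\lambda_n)$ of anti-Lyndon words with $w=\lambda_1\cdots\lambda_n$ and $\lambda_1\succeq_{in}\cdots\succeq_{in}\lambda_n$. A border of a nonempty word $x$ is a word that is both a proper prefix and a suffix of $x$; $x$ is bordered if it has a nonempty border, unbordered otherwise; every bordered word has exactly one nonempty unbordered border. $\mathcal{NB}(x)$: if $x$ is unbordered, $\mathcal{NB}(x)=(x)$; if bordered, with $z$ its unique nonempty unbordered border and $x=yz$, $\mathcal{NB}(x)=(\mathcal{NB}(y),z)$ (sequence $\mathcal{NB}(y)$ followed by $z$). -}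

module Defs where

open import Data.Nat using (ℕ)
open import Data.Fin using (Fin)
import Data.Fin as F
open import Data.List using (List; []; _∷_; _++_; concat; replicate; [_])
open import Data.List.Relation.Unary.All using (All)
open import Data.List.Relation.Unary.Linked using (Linked)
open import Data.Product using (Σ; ∃; _×_; _,_)
open import Data.Sum using (_⊎_)
open import Relation.Binary.PropositionalEquality using (_≡_; _≢_)

-- The alphabet: a finite totally ordered alphabet is (up to order isomorphism)
-- Fin k with its usual order.
Letter : ℕ → Set
Letter k = Fin k

Word : ℕ → Set
Word k = List (Letter k)

module _ {k : ℕ} where

  _<L_ : Letter k → Letter k → Set
  a <L b = a F.< b

  _<in_ : Letter k → Letter k → Set
  a <in b = b F.< a

  Lex : (Letter k → Letter k → Set) → Word k → Word k → Set
  Lex R x y =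
    (Σ (Word k) λ t → t ≢ [] × y ≡ x ++ t)
    ⊎ (Σ (Word k) λ r → Σ (Letter k) λ a → Σ (Word k) λ s →
       Σ (Letter k) λ b → Σ (Word k) λ t →
         x ≡ r ++ (a ∷ s) × y ≡ r ++ (b ∷ t) × R a b)

  _≺_ : Word k → Word k → Set
  _≺_ = Lex _<L_

  _≺in_ : Word k → Word k → Set
  _≺in_ = Lex _<in_

  _⪰in_ : Word k → Word k → Set
  x ⪰in y = y ≺in x ⊎ y ≡ x

  InverseLyndon : Word k → Set
  InverseLyndon u = u ≢ [] ×
    (∀ (p s : Word k) → p ≢ [] → s ≢ [] → u ≡ p ++ s → s ≺ u)

  Primitive : Word k → Set
  Primitive u = u ≢ [] × (∀ (v : Word k) (n : ℕ) → u ≡ concat (replicate n v) → n ≡ 1)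

  AntiLyndon : Word k → Set
  AntiLyndon u = Primitive u ×
    (∀ (x y : Word k) → u ≡ x ++ y → y ++ x ≢ u → u ≺in (y ++ x))

  PrefixOf : Word k → Word k → Set
  PrefixOf y x = Σ (Word k) λ t → x ≡ y ++ t

  _⊒_ : Word k → Word k → Set
  x ⊒ y = PrefixOf y x

  -- CFL_in(w) is the unique sequence of anti-Lyndon words with product w and
  -- λ₁ ⪰in ... ⪰in λₙ; this predicate characterises it.
  IsCFLin : Word k → List (Word k) → Set
  IsCFLin w ls = All AntiLyndon ls × concat ls ≡ w × Linked _⪰in_ ls

  Border : Word k → Word k → Set
  Border z x = (Σ (Word k) λ p → p ≢ [] × x ≡ z ++ p) × (Σ (Word k) λ q → x ≡ q ++ z)

  Unbordered : Word k → Set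
  Unbordered x = ∀ z → Border z x → z ≡ []

  -- graph of the function NB (NB x = ls  iff  NBRel x ls)
  data NBRel : Word k → List (Word k) → Set where
    nb-unb : ∀ {x} → x ≢ [] → Unbordered x → NBRel x [ x ]
    nb-bor : ∀ {x y z ls} → z ≢ [] → Border z x → Unbordered z → x ≡ y ++ z →
             NBRel y ls → NBRel x (ls ++ [ z ])

-- An anti-Lyndon word u is unbordered: a nonempty border z gives u = z p = q z, and
-- minimality of u among its conjugates z q and p z yields p ≺in q and q ≺in p, unless
-- p = q, in which case z p = p z makes u a proper power.  Since ℓ_h is a prefix of
-- ℓ_1, it is a border of ℓ_1 ⋯ ℓ_h; being unbordered it is the unique unbordered one,
-- so NB(ℓ_1 ⋯ ℓ_h) = (NB(ℓ_1 ⋯ ℓ_{h-1}), ℓ_h) and induction on h gives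
-- NB(m) = (ℓ_1, …, ℓ_h).  This is also CFL_in(m), since a word is ⪰in each of its
-- prefixes.
module Submission where

open import Defs
open import Data.Empty using (⊥; ⊥-elim)
open import Data.List using (List; []; _∷_; _++_; concat; replicate; [_]; length; _∷ʳ_)
open import Data.List.Properties
  using (++-assoc; ++-identityʳ; ++-cancelˡ; ++-cancelʳ; ++-conicalʳ; ∷-injective; ≡-dec;
         concat-++; length-++; length-++-comm; length-++-≤ʳ)
open import Data.List.Relation.Binary.Lex.Strict
  using (Lex-<; halt; this; next; <-irreflexive; <-asymmetric)
import Data.List.Relation.Binary.Pointwise as Pointwise
open import Data.List.Relation.Unary.All as All using (All; []; _∷_)
open import Data.List.Relation.Unary.All.Properties using (∷ʳ⁻)
open import Data.List.Relation.Unary.Linked as Linked using (Linked; [-]; _∷_)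
open import Data.List.Relation.Unary.Linked.Properties using (Linked⇒All)
open import Data.List.Reverse using (Reverse; []; _∶_∶ʳ_; reverseView)
import Data.Fin.Properties as FP
open import Data.Nat using (ℕ; zero; suc; _+_; _<_; s≤s; z≤n)
open import Data.Nat.Induction using (<-wellFounded)
open import Data.Nat.Properties
  using (m+1+n≢0; <-irrefl; suc-injective; +-cancelʳ-≡; module ≤-Reasoning)
open import Data.Product using (Σ; ∃-syntax; _×_; _,_)
open import Data.Sum using (_⊎_; inj₁; inj₂)
open import Function using (_∘_)
open import Induction.WellFounded using (Acc; acc)
open import Relation.Binary using (Rel; Irreflexive; Transitive)
open import Relation.Binary.PropositionalEquality
  using (_≡_; _≢_; refl; sym; trans; cong; subst; resp₂; module ≡-Reasoning)
open import Relation.Nullary using (yes; no)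

module _ {a} {A : Set a} where

  ++-equidivisible : ∀ (x u y v : List A) → x ++ u ≡ y ++ v →
                     (∃[ w ] y ≡ x ++ w × u ≡ w ++ v) ⊎ (∃[ w ] x ≡ y ++ w × v ≡ w ++ u)
  ++-equidivisible []      u y       v eq = inj₁ (y , refl , eq)
  ++-equidivisible (c ∷ x) u []      v eq = inj₂ (c ∷ x , refl , sym eq)
  ++-equidivisible (c ∷ x) u (d ∷ y) v eq with ∷-injective eq
  ... | refl , eq′ with ++-equidivisible x u y v eq′
  ... | inj₁ (w , refl , u≡wv) = inj₁ (w , refl , u≡wv)
  ... | inj₂ (w , refl , v≡wu) = inj₂ (w , refl , v≡wu)

  length-<-++ʳ : ∀ (x y : List A) → y ≢ [] → length x < length (x ++ y)
  length-<-++ʳ []      []      y≢[] = ⊥-elim (y≢[] refl)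
  length-<-++ʳ []      (_ ∷ _) _    = s≤s z≤n
  length-<-++ʳ (_ ∷ x) y       y≢[] = s≤s (length-<-++ʳ x y y≢[])

  length-<-++ˡ : ∀ (x y : List A) → x ≢ [] → length y < length (x ++ y)
  length-<-++ˡ x y x≢[] = subst (length y <_) (length-++-comm y x) (length-<-++ʳ y x x≢[])

  concat-∷ʳ : ∀ (xss : List (List A)) xs → concat xss ++ xs ≡ concat (xss ∷ʳ xs)
  concat-∷ʳ xss xs = trans (cong (concat xss ++_) (sym (++-identityʳ xs))) (concat-++ xss [ xs ])

  power : List A → ℕ → List A
  power t n = concat (replicate n t)

  power-+ : ∀ t m n → power t (m + n) ≡ power t m ++ power t n
  power-+ t zero    n = refl
  power-+ t (suc m) n =
    trans (cong (t ++_) (power-+ t m n)) (sym (++-assoc t (power t m) (power t n)))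

  CommonRoot : List A → List A → Set a
  CommonRoot x y = ∃[ t ] ∃[ m ] ∃[ n ] (x ≡ power t m × y ≡ power t n)

  commonRoot-swap : ∀ {x y} → CommonRoot x y → CommonRoot y x
  commonRoot-swap (t , m , n , x≡tᵐ , y≡tⁿ) = t , n , m , y≡tⁿ , x≡tᵐ

  commonRoot-++ : ∀ {x w} → CommonRoot x w → CommonRoot x (x ++ w)
  commonRoot-++ (t , m , n , refl , refl) = t , m , m + n , refl , sym (power-+ t m n)

  -- The Euclidean algorithm on lengths: peel the shorter word off the longer one.
  commute⇒commonRoot : ∀ x y → x ++ y ≡ y ++ x → CommonRoot x y
  commute⇒commonRoot x y = go x y (<-wellFounded (length (x ++ y)))
    where
    go : ∀ x y → Acc _<_ (length (x ++ y)) → x ++ y ≡ y ++ x → CommonRoot x y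
    go []          y _ _ = y , 0 , 1 , refl , sym (++-identityʳ y)
    go x@(_ ∷ _) [] _ _ = x , 1 , 0 , sym (++-identityʳ x) , refl
    go x@(_ ∷ _) y@(_ ∷ _) (acc rec) xy≡yx with ++-equidivisible x y y x xy≡yx
    ... | inj₁ (w , refl , xw≡wx) =
      commonRoot-++ (go x w (rec (length-<-++ˡ x (x ++ w) (λ ()))) xw≡wx)
    ... | inj₂ (w , refl , yw≡wy) =
      commonRoot-swap (commonRoot-++ (go y w (rec (length-<-++ʳ (y ++ w) y (λ ()))) yw≡wy))

module _ {a ℓ} {A : Set a} {_≺_ : Rel A ℓ} where

  Lex-<-proper-prefix : ∀ x {t} → t ≢ [] → Lex-< _≡_ _≺_ x (x ++ t)
  Lex-<-proper-prefix []      {[]}    t≢[] = ⊥-elim (t≢[] refl)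
  Lex-<-proper-prefix []      {_ ∷ _} _    = halt
  Lex-<-proper-prefix (_ ∷ x)         t≢[] = next refl (Lex-<-proper-prefix x t≢[])

  Lex-<-mismatch : ∀ r {a b s t} → a ≺ b → Lex-< _≡_ _≺_ (r ++ a ∷ s) (r ++ b ∷ t)
  Lex-<-mismatch []      a≺b = this a≺b
  Lex-<-mismatch (_ ∷ r) a≺b = next refl (Lex-<-mismatch r a≺b)

  module _ (≺-irrefl : Irreflexive _≡_ _≺_) where

    Lex-<-++-cancelˡ : ∀ c {x y} → Lex-< _≡_ _≺_ (c ++ x) (c ++ y) → Lex-< _≡_ _≺_ x y
    Lex-<-++-cancelˡ []      lt           = lt
    Lex-<-++-cancelˡ (_ ∷ c) (this a≺a)   = ⊥-elim (≺-irrefl refl a≺a)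
    Lex-<-++-cancelˡ (_ ∷ c) (next _ lt)  = Lex-<-++-cancelˡ c lt

    Lex-<-++-cancelʳ : ∀ {x y} c → length x ≡ length y →
                       Lex-< _≡_ _≺_ (x ++ c) (y ++ c) → Lex-< _≡_ _≺_ x y
    Lex-<-++-cancelʳ {[]}    {[]}    c _ c<c =
      ⊥-elim (<-irreflexive ≺-irrefl (Pointwise.refl refl) c<c)
    Lex-<-++-cancelʳ {_ ∷ _} {_ ∷ _} c _ (this a≺b) = this a≺b
    Lex-<-++-cancelʳ {_ ∷ _} {_ ∷ _} c |x|≡|y| (next refl lt) =
      next refl (Lex-<-++-cancelʳ c (suc-injective |x|≡|y|) lt)

∷-Linked⇒All : ∀ {a ℓ} {A : Set a} {R : Rel A ℓ} → Transitive R →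
               ∀ {x xs} → Linked R (x ∷ xs) → All (R x) xs
∷-Linked⇒All R-trans [-]         = []
∷-Linked⇒All R-trans (Rxy ∷ Rys) = Linked⇒All R-trans Rxy Rys

module _ {k : ℕ} where

  Lex⇒Lex-< : ∀ {R} {x y : Word k} → Lex R x y → Lex-< _≡_ R x y
  Lex⇒Lex-< (inj₁ (t , t≢[] , refl))                      = Lex-<-proper-prefix _ t≢[]
  Lex⇒Lex-< (inj₂ (r , _ , _ , _ , _ , refl , refl , aRb)) = Lex-<-mismatch r aRb

  commute⇒¬Primitive : ∀ (z p : Word k) → z ≢ [] → p ≢ [] → z ++ p ≡ p ++ z →
                       Primitive (z ++ p) → ⊥
  commute⇒¬Primitive z p z≢[] p≢[] zp≡pz (_ , power⇒n≡1)
    with commute⇒commonRoot z p zp≡pz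
  ... | t , zero  , n     , refl , _    = z≢[] refl
  ... | t , suc m , zero  , _    , refl = p≢[] refl
  ... | t , suc m , suc n , refl , refl =
    m+1+n≢0 m (suc-injective (power⇒n≡1 t (suc m + suc n) (sym (power-+ t (suc m) (suc n)))))

  antiLyndon⇒unbordered : ∀ {u : Word k} → AntiLyndon u → Unbordered u
  antiLyndon⇒unbordered _ [] _ = refl
  antiLyndon⇒unbordered (u-primitive , minimal) z@(_ ∷ _) ((p , p≢[] , refl) , (q , zp≡qz))
    with ≡-dec FP._≟_ p q
  ... | yes refl = ⊥-elim (commute⇒¬Primitive z p (λ ()) p≢[] zp≡qz u-primitive)
  ... | no p≢q   = ⊥-elim (<-asymmetric sym (resp₂ _<in_) FP.<-asym p<q q<p)
    where
    <in-irrefl : Irreflexive _≡_ (_<in_ {k})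
    <in-irrefl a≡b = FP.<-irrefl (sym a≡b)

    |q|≡|p| : length q ≡ length p
    |q|≡|p| = +-cancelʳ-≡ (length z) _ _ (begin
      length q + length z  ≡⟨ length-++ q ⟨
      length (q ++ z)      ≡⟨ cong length zp≡qz ⟨
      length (z ++ p)      ≡⟨ length-++-comm z p ⟩
      length (p ++ z)      ≡⟨ length-++ p ⟩
      length p + length z  ∎)
      where open ≡-Reasoning

    p<q : Lex-< _≡_ _<in_ p q
    p<q = Lex-<-++-cancelˡ <in-irrefl z
      (Lex⇒Lex-< (minimal q z zp≡qz (p≢q ∘ sym ∘ ++-cancelˡ z q p)))

    q<p : Lex-< _≡_ _<in_ q p
    q<p = Lex-<-++-cancelʳ <in-irrefl z |q|≡|p|
      (subst (λ w → Lex-< _≡_ _<in_ w (p ++ z)) zp≡qz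
        (Lex⇒Lex-< (minimal z p refl λ pz≡zp → p≢q (++-cancelʳ z p q (trans pz≡zp zp≡qz)))))

  ⊒-trans : Transitive (_⊒_ {k})
  ⊒-trans {_} {_} {z} (s , refl) (t , refl) = t ++ s , ++-assoc z t s

  ⊒-++ : ∀ {x y : Word k} z → x ⊒ y → (x ++ z) ⊒ y
  ⊒-++ {y = y} z (t , refl) = t ++ z , ++-assoc y t z

  ⊒⇒⪰in : ∀ {x y : Word k} → x ⊒ y → x ⪰in y
  ⊒⇒⪰in {y = y} ([] , x≡y++[]) = inj₂ (sym (trans x≡y++[] (++-identityʳ y)))
  ⊒⇒⪰in (t@(_ ∷ _) , x≡yt)      = inj₁ (inj₁ (t , (λ ()) , x≡yt))

  border-of-longer-border : ∀ {x z z′ w : Word k} → Border z x → Border z′ x →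
                            z′ ≡ z ++ w → w ≢ [] → Border z z′
  border-of-longer-border {z = z} {z′} {w} (_ , (q , x≡qz)) (_ , (q′ , x≡q′z′)) z′≡zw w≢[]
    with ++-equidivisible q z q′ z′ (trans (sym x≡qz) x≡q′z′)
  ... | inj₂ (v , _ , z′≡vz) = (w , w≢[] , z′≡zw) , (v , z′≡vz)
  ... | inj₁ (v , _ , z≡vz′) = ⊥-elim (<-irrefl refl (begin-strict
    length z         <⟨ length-<-++ʳ z w w≢[] ⟩
    length (z ++ w)  ≡⟨ cong length z′≡zw ⟨
    length z′        ≤⟨ length-++-≤ʳ z′ {v} ⟩
    length (v ++ z′) ≡⟨ cong length z≡vz′ ⟨
    length z         ∎))
    where open ≤-Reasoning

  unbordered-border-unique : ∀ {x z z′ : Word k} → z ≢ [] → z′ ≢ [] →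
                             Border z x → Border z′ x → Unbordered z → Unbordered z′ → z ≡ z′
  unbordered-border-unique {z = z} {z′} z≢[] z′≢[]
                           bz@((p , _ , x≡zp) , _) bz′@((p′ , _ , x≡z′p′) , _) z-unb z′-unb
    with ++-equidivisible z p z′ p′ (trans (sym x≡zp) x≡z′p′)
  ... | inj₁ ([] , z′≡z++[] , _) = sym (trans z′≡z++[] (++-identityʳ z))
  ... | inj₂ ([] , z≡z′++[] , _) = trans z≡z′++[] (++-identityʳ z′)
  ... | inj₁ (_ ∷ _ , z′≡zw , _) =
    ⊥-elim (z≢[] (z′-unb z (border-of-longer-border bz bz′ z′≡zw (λ ()))))
  ... | inj₂ (_ ∷ _ , z≡z′w , _) =
    ⊥-elim (z′≢[] (z-unb z′ (border-of-longer-border bz′ bz z≡z′w (λ ()))))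

  NBRel-functional : ∀ {x : Word k} {ls ls′} → NBRel x ls → NBRel x ls′ → ls ≡ ls′
  NBRel-functional (nb-unb _ _)              (nb-unb _ _)              = refl
  NBRel-functional (nb-unb _ x-unb)          (nb-bor z≢[] bz _ _ _)    = ⊥-elim (z≢[] (x-unb _ bz))
  NBRel-functional (nb-bor z≢[] bz _ _ _)    (nb-unb _ x-unb)          = ⊥-elim (z≢[] (x-unb _ bz))
  NBRel-functional (nb-bor {y = y} {z} z≢[] bz z-unb x≡yz nb)
                   (nb-bor {y = y′} z′≢[] bz′ z′-unb x≡y′z′ nb′)
    with unbordered-border-unique z≢[] z′≢[] bz bz′ z-unb z′-unb
  ... | refl with ++-cancelʳ z y y′ (trans (sym x≡yz) x≡y′z′)
  ... | refl = cong (_∷ʳ z) (NBRel-functional nb nb′)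

  NBRel-∷ʳ : ∀ {y z : Word k} {ls} → NBRel y ls → z ≢ [] → Unbordered z → y ⊒ z →
             NBRel (y ++ z) (ls ∷ʳ z)
  NBRel-∷ʳ {z = z} nb z≢[] z-unb (t , refl) = nb-bor z≢[] z-border z-unb refl nb
    where
    z-border : Border z ((z ++ t) ++ z)
    z-border = (t ++ z , z≢[] ∘ ++-conicalʳ t z , ++-assoc z t z) , (z ++ t , refl)

  NBRel-concat : ∀ {h : Word k} {ls} → Reverse ls →
                 All (λ w → w ≢ [] × Unbordered w) (h ∷ ls) → All (h ⊒_) ls →
                 NBRel (concat (h ∷ ls)) (h ∷ ls)
  NBRel-concat {h} [] ((h≢[] , h-unb) ∷ []) [] =
    subst (λ w → NBRel w [ h ]) (sym (++-identityʳ h)) (nb-unb h≢[] h-unb)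
  NBRel-concat {h} (ls ∶ rls ∶ʳ x) (h-nu ∷ nus) h⊒ls∷ʳx =
    let nus′ , (x≢[] , x-unb) = ∷ʳ⁻ nus
        h⊒ls , h⊒x             = ∷ʳ⁻ h⊒ls∷ʳx
    in subst (λ w → NBRel w (h ∷ ls ∷ʳ x)) (concat-∷ʳ (h ∷ ls) x)
         (NBRel-∷ʳ (NBRel-concat rls (h-nu ∷ nus′) h⊒ls) x≢[] x-unb (⊒-++ (concat ls) h⊒x))

proposition8p8 : (k : ℕ) (m : Word k) (ls : List (Word k)) →
    InverseLyndon m →
    All AntiLyndon ls →
    Linked _⊒_ ls →
    m ≡ concat ls →
    (Σ (List (Word k)) λ nb → NBRel m nb) ×
    (∀ (nb : List (Word k)) → NBRel m nb → IsCFLin m nb)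
proposition8p8 k m []            (m≢[] , _) _          _      m≡[] = ⊥-elim (m≢[] m≡[])
proposition8p8 k m ls@(h ∷ rest) _          antiLyndon linked refl =
  (ls , nb) , λ _ nb-m → subst (IsCFLin m) (NBRel-functional nb nb-m) cfl
  where
  nb : NBRel m ls
  nb = NBRel-concat (reverseView rest)
         (All.map (λ al@((u≢[] , _) , _) → u≢[] , antiLyndon⇒unbordered al) antiLyndon)
         (∷-Linked⇒All ⊒-trans linked)

  cfl : IsCFLin m ls
  cfl = antiLyndon , refl , Linked.map ⊒⇒⪰in linked
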